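{- Let $\Gamma$ be a finite, connected, simple, undirected graph with at least one edge, $G$ a group, and $s_1,s_2\in Z(G)$ with $s_1^2=s_2^2=1_G$. For a pair $(\psi,\zeta)\in G(\Gamma)\times G(L(\Gamma))$, the following are equivalent: (1) $(\psi,\zeta)$ is compatible; (2) $\mathcal L([\psi])=[\zeta]$. In particular, if $(\psi,\zeta)$ is compatible then $(\psi',\zeta')$ is compatible for every $\psi'$ switching equivalent to $\psi$ and every $\zeta'$ switching equivalent to $\zeta$.
   Context: Fix orders $V_\Gamma=\{v_1,\dots,v_n\}$, $E_\Gamma=\{e_1,\dots,e_m\}$; write $v_i\in e_j$ if $v_i$ is an endpoint of $e_j$, and $e_i\cap e_j$ for the common endpoint of distinct edges sharing a vertex. $\mathbb CG$ is the complex group algebra of $G$. A $G$-phase is $H\in M_{n\times m}(\mathbb CG)$ with $H_{i,j}\in G$ if $v_i\in e_j$ and $H_{i,j}=0$ otherwise; $\mathcal H_\Gamma$ is their set. A $G$-gain function on a graph is a map $\psi$ on ordered pairs of adjacent vertices into $G$ with $\psi(v,u)=\psi(u,v)^{ -1}$; $G(\Gamma)$ denotes those on $\Gamma$. Gain functions $\psi_1,\psi_2$ on the same graph are switching equivalent if there is a map $f$ from vertices to $G$ with $\psi_2(u,v)=f(u)^{ -1}\psi_1(u,v)f(v)$ for all adjacent $u,v$; $[\psi]$ denotes the class and $[G(\Gamma)]$ the set of classes. The line graph $L(\Gamma)$ has vertex set $E_\Gamma$, $e_i\sim e_j$ iff they share an endpoint. $\Psi(H)\in G(\Gamma)$ is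 given by $\Psi(H)(v_i,v_j)=s_1H_{i,k}H_{j,k}^{ -1}$ for $e_k=\{v_i,v_j\}$, and $\Psi_L(H)\in G(L(\Gamma))$ by $\Psi_L(H)(e_i,e_j)=s_2H_{k,i}^{ -1}H_{k,j}$ for $v_k=e_i\cap e_j$. A pair $(\psi,\zeta)$ is compatible if there is $H\in\mathcal H_\Gamma$ with $\Psi(H)=\psi$ and $\Psi_L(H)=\zeta$. $\mathcal L\colon[G(\Gamma)]\to[G(L(\Gamma))]$ is the map with $\mathcal L([\Psi(H)])=[\Psi_L(H)]$ for all $H\in\mathcal H_\Gamma$ (every gain function on $\Gamma$ is of the form $\Psi(H)$, and $[\Psi_L(H)]$ depends only on $[\Psi(H)]$, so this is a well-defined map). -}

module Defs where

open import Level using (Level; _⊔_)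
open import Data.Nat using (ℕ; suc; _≤_)
open import Data.Fin using (Fin; _≟_)
open import Data.Fin.Properties using (any?)
open import Data.Product using (Σ; ∃; _×_; _,_; proj₁; proj₂)
open import Data.Sum using (_⊎_; inj₁; inj₂)
open import Relation.Nullary using (¬_; Dec)
open import Relation.Nullary.Decidable using (True; toWitness; _×-dec_; _⊎-dec_; ¬?)
open import Relation.Binary.PropositionalEquality using (_≡_; _≢_; refl; sym)
open import Relation.Binary.Construct.Closure.ReflexiveTransitive using (Star)
open import Algebra.Bundles using (Group)

-- Finite simple undirected graphs with ordered vertices v_0..v_{n-1}
-- and ordered edges e_0..e_{m-1}; edge e_j has endpoints src j, tgt j
-- (the orientation src/tgt is only a presentation of the unordered pair).

record Graph : Set where
  field
    n m      : ℕ
    src tgt  : Fin m → Fin n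
    loopless : ∀ j → src j ≢ tgt j
    simple   : ∀ j k →
               ((src j ≡ src k × tgt j ≡ tgt k) ⊎ (src j ≡ tgt k × tgt j ≡ src k)) →
               j ≡ k

  Inc : Fin n → Fin m → Set
  Inc i j = (src j ≡ i) ⊎ (tgt j ≡ i)

  Inc? : ∀ i j → Dec (Inc i j)
  Inc? i j = (src j ≟ i) ⊎-dec (tgt j ≟ i)

  Ends : Fin m → Fin n → Fin n → Set
  Ends j u v = (src j ≡ u × tgt j ≡ v) ⊎ (src j ≡ v × tgt j ≡ u)

  Ends? : ∀ j u v → Dec (Ends j u v)
  Ends? j u v = ((src j ≟ u) ×-dec (tgt j ≟ v)) ⊎-dec ((src j ≟ v) ×-dec (tgt j ≟ u))

  -- adjacency in Γ (proof-irrelevant, decided)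
  adj? : ∀ u v → Dec (∃ λ j → Ends j u v)
  adj? u v = any? (λ j → Ends? j u v)

  Adj : Fin n → Fin n → Set
  Adj u v = True (adj? u v)

  edgeOf : ∀ {u v} → Adj u v → Fin m
  edgeOf p = proj₁ (toWitness p)

  incL : ∀ {u v} (p : Adj u v) → Inc u (edgeOf p)
  incL p with proj₂ (toWitness p)
  ... | inj₁ (a , _) = inj₁ a
  ... | inj₂ (_ , b) = inj₂ b

  incR : ∀ {u v} (p : Adj u v) → Inc v (edgeOf p)
  incR p with proj₂ (toWitness p)
  ... | inj₁ (_ , b) = inj₂ b
  ... | inj₂ (a , _) = inj₁ a

  ladj? : ∀ j k → Dec (¬ (j ≡ k) × ∃ λ i → Inc i j × Inc i k)
  ladj? j k = ¬? (j ≟ k) ×-dec any? (λ i → Inc? i j ×-dec Inc? i k)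

  LAdj : Fin m → Fin m → Set
  LAdj j k = True (ladj? j k)

  meet : ∀ {j k} → LAdj j k → Fin n
  meet p = proj₁ (proj₂ (toWitness p))

  meetL : ∀ {j k} (p : LAdj j k) → Inc (meet p) j
  meetL p = proj₁ (proj₂ (proj₂ (toWitness p)))

  meetR : ∀ {j k} (p : LAdj j k) → Inc (meet p) k
  meetR p = proj₂ (proj₂ (proj₂ (toWitness p)))

  Connected : Set
  Connected = ∀ u v → Star Adj u v

open Graph public

module GainTheory {c ℓ : Level} (G : Group c ℓ) where
  open Group G

  Central : Carrier → Set (c ⊔ ℓ)
  Central s = ∀ g → s ∙ g ≈ g ∙ s

  record Gain {k : ℕ} (A : Fin k → Fin k → Set) : Set (c ⊔ ℓ) where
    field
      gain : ∀ u v → A u v → Carrier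
      gain-inv : ∀ u v (p : A u v) (q : A v u) → gain v u q ≈ (gain u v p) ⁻¹
  open Gain public

  SwitchEq : ∀ {k} {A : Fin k → Fin k → Set} → Gain A → Gain A → Set (c ⊔ ℓ)
  SwitchEq {k} {A} ψ₁ ψ₂ =
    Σ (Fin k → Carrier) λ f →
      ∀ u v (p : A u v) → gain ψ₂ u v p ≈ ((f u) ⁻¹ ∙ gain ψ₁ u v p) ∙ f v

  module _ (Γ : Graph) (s₁ s₂ : Carrier) where

    -- G-phases: H_{i,j} ∈ G whenever v_i ∈ e_j (the zero entries carry no data)
    Phase : Set c
    Phase = ∀ i j → Inc Γ i j → Carrier

    Ψ : Phase → ∀ u v → Adj Γ u v → Carrier
    Ψ H u v p = s₁ ∙ (H u (edgeOf Γ p) (incL Γ p) ∙ (H v (edgeOf Γ p) (incR Γ p)) ⁻¹)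

    ΨL : Phase → ∀ j k → LAdj Γ j k → Carrier
    ΨL H j k p = s₂ ∙ ((H (meet Γ p) j (meetL Γ p)) ⁻¹ ∙ H (meet Γ p) k (meetR Γ p))

    _IsΨ_ : Gain (Adj Γ) → Phase → Set ℓ
    ψ IsΨ H = ∀ u v (p : Adj Γ u v) → gain ψ u v p ≈ Ψ H u v p

    _IsΨL_ : Gain (LAdj Γ) → Phase → Set ℓ
    ζ IsΨL H = ∀ j k (p : LAdj Γ j k) → gain ζ j k p ≈ ΨL H j k p

    Compatible : Gain (Adj Γ) → Gain (LAdj Γ) → Set (c ⊔ ℓ)
    Compatible ψ ζ = Σ Phase λ H → (ψ IsΨ H) × (ζ IsΨL H)

    -- 𝓛([ψ]) = [ζ] : 𝓛 sends the class [Ψ(H)] to [Ψ_L(H)] for every phase H;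
    -- so 𝓛([ψ]) = [ζ] means: for every H with [Ψ(H)] = [ψ], [Ψ_L(H)] = [ζ].
    -- (Ψ(H), Ψ_L(H) are compared with ψ, ζ through gain functions that
    -- agree with them pointwise.)
    𝓛[_]≡[_] : Gain (Adj Γ) → Gain (LAdj Γ) → Set (c ⊔ ℓ)
    𝓛[ ψ ]≡[ ζ ] = ∀ (H : Phase) (φ : Gain (Adj Γ)) (χ : Gain (LAdj Γ)) →
                   φ IsΨ H → χ IsΨL H → SwitchEq φ ψ → SwitchEq χ ζ

-- A phase H determines both gain functions Ψ(H) on Γ and Ψ_L(H) on L(Γ), and
-- rescaling the rows and columns of H, H ↦ f⁻¹ H g, switches Ψ(H) by f and Ψ_L(H) by g
-- (s₁, s₂ are central).  Conversely, Ψ(H) determines H up to exactly such a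
-- rescaling: if Ψ(H₀) is the f-switch of Ψ(H), then H₀ = f⁻¹ H g, where g is read
-- off at one endpoint of each edge.  Hence Ψ_L(H₀) is a switch of Ψ_L(H), which is
-- both the well-definedness of 𝓛 and the forward implication; the backward one
-- follows because every gain function on Γ is some Ψ(H).
module Submission where

open import Defs
open import Level using (Level)
open import Data.Nat using (_≤_)
open import Data.Fin using (Fin; _≟_)
open import Data.Product using (Σ; _×_; _,_; proj₁; proj₂)
open import Data.Sum using (_⊎_; inj₁; inj₂)
open import Data.Empty using (⊥-elim)
open import Data.Bool.Properties using (T-irrelevant)
open import Relation.Nullary using (yes; no)
open import Relation.Nullary.Decidable using (fromWitness; toWitness)
open import Relation.Binary.PropositionalEquality as ≡
  using (_≡_; _≢_)
open import Axiom.UniquenessOfIdentityProofs using (module Decidable⇒UIP)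
open import Function.Bundles using (_⇔_; mk⇔)
open import Algebra.Bundles using (Group)

module _ (Γ : Graph) where

  Inc-irrelevant : ∀ {i k} (q q′ : Inc Γ i k) → q ≡ q′
  Inc-irrelevant (inj₁ a) (inj₁ b) = ≡.cong inj₁ (Decidable⇒UIP.≡-irrelevant _≟_ a b)
  Inc-irrelevant {k = k} (inj₁ a) (inj₂ b) = ⊥-elim (loopless Γ k (≡.trans a (≡.sym b)))
  Inc-irrelevant {k = k} (inj₂ a) (inj₁ b) = ⊥-elim (loopless Γ k (≡.trans b (≡.sym a)))
  Inc-irrelevant (inj₂ a) (inj₂ b) = ≡.cong inj₂ (Decidable⇒UIP.≡-irrelevant _≟_ a b)

  Ends⇒≡ : ∀ {j k u v} → Ends Γ j u v → Ends Γ k u v → j ≡ k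
  Ends⇒≡ {j} {k} {u} {v} e e′ = simple Γ j k (same-pair e e′)
    where
    same-pair : Ends Γ j u v → Ends Γ k u v →
      (src Γ j ≡ src Γ k × tgt Γ j ≡ tgt Γ k) ⊎ (src Γ j ≡ tgt Γ k × tgt Γ j ≡ src Γ k)
    same-pair (inj₁ (a , b)) (inj₁ (c , d)) = inj₁ (≡.trans a (≡.sym c) , ≡.trans b (≡.sym d))
    same-pair (inj₁ (a , b)) (inj₂ (c , d)) = inj₂ (≡.trans a (≡.sym d) , ≡.trans b (≡.sym c))
    same-pair (inj₂ (a , b)) (inj₁ (c , d)) = inj₂ (≡.trans a (≡.sym d) , ≡.trans b (≡.sym c))
    same-pair (inj₂ (a , b)) (inj₂ (c , d)) = inj₁ (≡.trans a (≡.sym c) , ≡.trans b (≡.sym d))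

  edgeAdj : ∀ k → Adj Γ (src Γ k) (tgt Γ k)
  edgeAdj k = fromWitness (k , inj₁ (≡.refl , ≡.refl))

  edgeOf-unique : ∀ {k u v} → Ends Γ k u v → (p : Adj Γ u v) → edgeOf Γ p ≡ k
  edgeOf-unique e p = Ends⇒≡ (proj₂ (toWitness p)) e

  Inc⇒Ends : ∀ {i i′ j} → Inc Γ i j → Inc Γ i′ j → i ≢ i′ → Ends Γ j i i′
  Inc⇒Ends (inj₁ a) (inj₁ b) i≢i′ = ⊥-elim (i≢i′ (≡.trans (≡.sym a) b))
  Inc⇒Ends (inj₁ a) (inj₂ b) _ = inj₁ (a , b)
  Inc⇒Ends (inj₂ a) (inj₁ b) _ = inj₂ (b , a)
  Inc⇒Ends (inj₂ a) (inj₂ b) i≢i′ = ⊥-elim (i≢i′ (≡.trans (≡.sym a) b))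

  shared-endpoint-unique : ∀ {i i′ j k} → j ≢ k →
    Inc Γ i j → Inc Γ i k → Inc Γ i′ j → Inc Γ i′ k → i ≡ i′
  shared-endpoint-unique {i} {i′} j≢k ij ik i′j i′k with i ≟ i′
  ... | yes i≡i′ = i≡i′
  ... | no i≢i′ = ⊥-elim (j≢k (Ends⇒≡ (Inc⇒Ends ij i′j i≢i′) (Inc⇒Ends ik i′k i≢i′)))

  meet-comm : ∀ {j k} (p : LAdj Γ j k) (q : LAdj Γ k j) → meet Γ q ≡ meet Γ p
  meet-comm p q = shared-endpoint-unique (proj₁ (toWitness p))
    (meetR Γ q) (meetL Γ q) (meetL Γ p) (meetR Γ p)

module SwitchedProperties {c ℓ : Level} (G : Group c ℓ) where
  open Group G
  open import Algebra.Properties.Group G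
    using (⁻¹-anti-homo-∙; ⁻¹-involutive; ⁻¹-injective; ∙-cancelˡ; ε⁻¹≈ε; inverseʳ-unique)
  open import Algebra.Properties.Monoid monoid using (cancelˡ; cancelʳ; cancelᶜ)
  open import Relation.Binary.Reasoning.Setoid setoid
  open GainTheory G using (Central; Gain; gain; SwitchEq)

  switched : Carrier → Carrier → Carrier → Carrier
  switched a x b = (a ⁻¹ ∙ x) ∙ b

  switched-cong : ∀ a {x y} b → x ≈ y → switched a x b ≈ switched a y b
  switched-cong a b x≈y = ∙-congʳ (∙-congˡ x≈y)

  switched-∙ : ∀ a x b y d → switched a x b ∙ switched b y d ≈ switched a (x ∙ y) d
  switched-∙ a x b y d = begin
    (a ⁻¹ ∙ x ∙ b) ∙ (b ⁻¹ ∙ y ∙ d)   ≈⟨ ∙-congˡ (assoc _ _ _) ⟩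
    (a ⁻¹ ∙ x ∙ b) ∙ (b ⁻¹ ∙ (y ∙ d)) ≈⟨ cancelᶜ (inverseʳ b) _ _ ⟩
    (a ⁻¹ ∙ x) ∙ (y ∙ d)              ≈⟨ assoc _ _ _ ⟨
    a ⁻¹ ∙ x ∙ y ∙ d                  ≈⟨ ∙-congʳ (assoc _ _ _) ⟩
    a ⁻¹ ∙ (x ∙ y) ∙ d                ∎

  switched-⁻¹ : ∀ a x b → (switched a x b) ⁻¹ ≈ switched b (x ⁻¹) a
  switched-⁻¹ a x b = begin
    (a ⁻¹ ∙ x ∙ b) ⁻¹         ≈⟨ ⁻¹-anti-homo-∙ _ _ ⟩
    b ⁻¹ ∙ (a ⁻¹ ∙ x) ⁻¹      ≈⟨ ∙-congˡ (⁻¹-anti-homo-∙ _ _) ⟩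
    b ⁻¹ ∙ (x ⁻¹ ∙ a ⁻¹ ⁻¹)   ≈⟨ ∙-congˡ (∙-congˡ (⁻¹-involutive a)) ⟩
    b ⁻¹ ∙ (x ⁻¹ ∙ a)         ≈⟨ assoc _ _ _ ⟨
    b ⁻¹ ∙ x ⁻¹ ∙ a           ∎

  switched-ε : ∀ x → switched ε x ε ≈ x
  switched-ε x = begin
    ε ⁻¹ ∙ x ∙ ε  ≈⟨ identityʳ _ ⟩
    ε ⁻¹ ∙ x      ≈⟨ ∙-congʳ ε⁻¹≈ε ⟩
    ε ∙ x         ≈⟨ identityˡ x ⟩
    x             ∎

  switchEq-refl : ∀ {k} {A : Fin k → Fin k → Set} (ψ : Gain A) → SwitchEq ψ ψ
  switchEq-refl ψ = (λ _ → ε) , λ u v p → sym (switched-ε (gain ψ u v p))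

  switched-unswitch : ∀ a x y → switched a x (switched x a y) ≈ y
  switched-unswitch a x y = begin
    (a ⁻¹ ∙ x) ∙ (x ⁻¹ ∙ a ∙ y)   ≈⟨ ∙-congˡ (assoc _ _ _) ⟩
    (a ⁻¹ ∙ x) ∙ (x ⁻¹ ∙ (a ∙ y)) ≈⟨ cancelᶜ (inverseʳ x) _ _ ⟩
    a ⁻¹ ∙ (a ∙ y)                ≈⟨ cancelˡ (inverseˡ a) y ⟩
    y                             ∎

  -- A switch is fixed by its value at one end; this is why Ψ determines a phase
  -- up to column factors.
  switched-determined : ∀ {a b d x y x₀ y₀} → x₀ ≈ switched a x d →
    x₀ ∙ y₀ ⁻¹ ≈ switched a (x ∙ y ⁻¹) b → y₀ ≈ switched b y d
  switched-determined {a} {b} {d} {x} {y} {x₀} {y₀} hx hxy =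
    ⁻¹-injective (∙-cancelˡ x₀ _ _ (begin
      x₀ ∙ y₀ ⁻¹                              ≈⟨ hxy ⟩
      switched a (x ∙ y ⁻¹) b                 ≈⟨ switched-∙ a x d (y ⁻¹) b ⟨
      switched a x d ∙ switched d (y ⁻¹) b    ≈⟨ ∙-cong hx (switched-⁻¹ b y d) ⟨
      x₀ ∙ (switched b y d) ⁻¹                ∎))

  module _ {s : Carrier} (s-central : Central s) where

    central-switched : ∀ a x b → s ∙ switched a x b ≈ switched a (s ∙ x) b
    central-switched a x b = begin
      s ∙ (a ⁻¹ ∙ x ∙ b)   ≈⟨ assoc _ _ _ ⟨
      s ∙ (a ⁻¹ ∙ x) ∙ b   ≈⟨ ∙-congʳ (assoc _ _ _) ⟨
      s ∙ a ⁻¹ ∙ x ∙ b     ≈⟨ ∙-congʳ (∙-congʳ (s-central (a ⁻¹))) ⟩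
      a ⁻¹ ∙ s ∙ x ∙ b     ≈⟨ ∙-congʳ (assoc _ _ _) ⟩
      a ⁻¹ ∙ (s ∙ x) ∙ b   ∎

    central-switched-∙ : ∀ a x b y d →
      s ∙ (switched a x b ∙ switched b y d) ≈ switched a (s ∙ (x ∙ y)) d
    central-switched-∙ a x b y d =
      trans (∙-congˡ (switched-∙ a x b y d)) (central-switched a (x ∙ y) d)

    central-cancel : ∀ x → s ∙ (x ∙ s ⁻¹) ≈ x
    central-cancel x = trans (s-central _) (cancelʳ (inverseˡ s) x)

    central-involution-⁻¹ : s ∙ s ≈ ε → ∀ x → (s ∙ x) ⁻¹ ≈ s ∙ x ⁻¹
    central-involution-⁻¹ s-involution x = begin
      (s ∙ x) ⁻¹      ≈⟨ ⁻¹-anti-homo-∙ s x ⟩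
      x ⁻¹ ∙ s ⁻¹     ≈⟨ ∙-congˡ (inverseʳ-unique s s s-involution) ⟨
      x ⁻¹ ∙ s        ≈⟨ s-central (x ⁻¹) ⟨
      s ∙ x ⁻¹        ∎

module Compatibility {c ℓ : Level} (Γ : Graph) (G : Group c ℓ) (s₁ s₂ : Group.Carrier G)
  (s₁-central : GainTheory.Central G s₁) (s₂-central : GainTheory.Central G s₂)
  (s₁-involution : Group._≈_ G (Group._∙_ G s₁ s₁) (Group.ε G))
  (s₂-involution : Group._≈_ G (Group._∙_ G s₂ s₂) (Group.ε G)) where
  open Group G
  open import Algebra.Properties.Group G using (∙-cancelˡ; ⁻¹-anti-homo-\\)
  open import Algebra.Properties.Monoid monoid using (cancelˡ)
  open import Relation.Binary.Reasoning.Setoid setoid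
  open GainTheory G
  open SwitchedProperties G

  entry-cong : ∀ (H : Phase Γ s₁ s₂) {i i′ k k′} → i ≡ i′ → k ≡ k′ →
    (q : Inc Γ i k) (q′ : Inc Γ i′ k′) → H i k q ≡ H i′ k′ q′
  entry-cong H ≡.refl ≡.refl q q′ = ≡.cong (H _ _) (Inc-irrelevant Γ q q′)

  Ψ-at : ∀ H {k u v} → Ends Γ k u v → (p : Adj Γ u v) (q : Inc Γ u k) (q′ : Inc Γ v k) →
    Ψ Γ s₁ s₂ H u v p ≡ s₁ ∙ (H u k q ∙ (H v k q′) ⁻¹)
  Ψ-at H e p q q′ = ≡.cong₂ (λ x y → s₁ ∙ (x ∙ y ⁻¹))
    (entry-cong H ≡.refl (edgeOf-unique Γ e p) _ q)
    (entry-cong H ≡.refl (edgeOf-unique Γ e p) _ q′)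

  switchPhase : (Fin (n Γ) → Carrier) → (Fin (m Γ) → Carrier) →
    Phase Γ s₁ s₂ → Phase Γ s₁ s₂
  switchPhase f g H i k q = switched (f i) (H i k q) (g k)

  Ψ-switchPhase : ∀ f g H u v (p : Adj Γ u v) →
    Ψ Γ s₁ s₂ (switchPhase f g H) u v p ≈ switched (f u) (Ψ Γ s₁ s₂ H u v p) (f v)
  Ψ-switchPhase f g H u v p = trans (∙-congˡ (∙-congˡ (switched-⁻¹ _ _ _)))
    (central-switched-∙ s₁-central _ _ _ _ _)

  ΨL-switchPhase : ∀ f g H j k (p : LAdj Γ j k) →
    ΨL Γ s₁ s₂ (switchPhase f g H) j k p ≈ switched (g j) (ΨL Γ s₁ s₂ H j k p) (g k)
  ΨL-switchPhase f g H j k p = trans (∙-congˡ (∙-congʳ (switched-⁻¹ _ _ _)))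
    (central-switched-∙ s₂-central _ _ _ _ _)

  ΨL-cong : ∀ {H H′ : Phase Γ s₁ s₂} → (∀ i k q → H i k q ≈ H′ i k q) →
    ∀ j k (p : LAdj Γ j k) → ΨL Γ s₁ s₂ H j k p ≈ ΨL Γ s₁ s₂ H′ j k p
  ΨL-cong H≈H′ j k p = ∙-congˡ (∙-cong (⁻¹-cong (H≈H′ _ _ _)) (H≈H′ _ _ _))

  Ψ-rigid : ∀ f (H₀ H : Phase Γ s₁ s₂) →
    (∀ u v (p : Adj Γ u v) → Ψ Γ s₁ s₂ H₀ u v p ≈ switched (f u) (Ψ Γ s₁ s₂ H u v p) (f v)) →
    Σ (Fin (m Γ) → Carrier) λ g → ∀ i k q → H₀ i k q ≈ switchPhase f g H i k q
  Ψ-rigid f H₀ H Ψ≈ = g , entries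
    where
    g : Fin (m Γ) → Carrier
    g k = switched (H (src Γ k) k (inj₁ ≡.refl)) (f (src Γ k)) (H₀ (src Γ k) k (inj₁ ≡.refl))

    at-src : ∀ k → H₀ (src Γ k) k (inj₁ ≡.refl) ≈ switchPhase f g H (src Γ k) k (inj₁ ≡.refl)
    at-src k = sym (switched-unswitch _ _ _)

    at-tgt : ∀ k → H₀ (tgt Γ k) k (inj₂ ≡.refl) ≈ switchPhase f g H (tgt Γ k) k (inj₂ ≡.refl)
    at-tgt k = switched-determined (at-src k) (∙-cancelˡ s₁ _ _ (begin
      s₁ ∙ (x₀ ∙ y₀ ⁻¹)                      ≡⟨ Ψ-at H₀ e p _ _ ⟨
      Ψ Γ s₁ s₂ H₀ u v p                     ≈⟨ Ψ≈ u v p ⟩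
      switched (f u) (Ψ Γ s₁ s₂ H u v p) (f v)
        ≡⟨ ≡.cong (λ z → switched (f u) z (f v)) (Ψ-at H e p _ _) ⟩
      switched (f u) (s₁ ∙ (x ∙ y ⁻¹)) (f v) ≈⟨ central-switched s₁-central _ _ _ ⟨
      s₁ ∙ switched (f u) (x ∙ y ⁻¹) (f v)   ∎))
      where
      u v : Fin (n Γ)
      u = src Γ k
      v = tgt Γ k
      e : Ends Γ k u v
      e = inj₁ (≡.refl , ≡.refl)
      p : Adj Γ u v
      p = edgeAdj Γ k
      x y x₀ y₀ : Carrier
      x = H u k (inj₁ ≡.refl)
      y = H v k (inj₂ ≡.refl)
      x₀ = H₀ u k (inj₁ ≡.refl)
      y₀ = H₀ v k (inj₂ ≡.refl)

    entries : ∀ i k q → H₀ i k q ≈ switchPhase f g H i k q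
    entries _ k (inj₁ ≡.refl) = at-src k
    entries _ k (inj₂ ≡.refl) = at-tgt k

  -- ψ(e) at the source of e and s₁ at its target; s₁² = 1 makes Ψ recover ψ
  -- on both orientations.
  phaseOf : Gain (Adj Γ) → Phase Γ s₁ s₂
  phaseOf ψ _ k (inj₁ _) = gain ψ (src Γ k) (tgt Γ k) (edgeAdj Γ k)
  phaseOf ψ _ k (inj₂ _) = s₁

  Ψ-phaseOf : ∀ ψ → _IsΨ_ Γ s₁ s₂ ψ (phaseOf ψ)
  Ψ-phaseOf ψ u v p = at (proj₂ (toWitness p)) p
    where
    at : ∀ {k u v} → Ends Γ k u v → (p : Adj Γ u v) →
      gain ψ u v p ≈ Ψ Γ s₁ s₂ (phaseOf ψ) u v p
    at {k} e@(inj₁ (≡.refl , ≡.refl)) p = begin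
      gain ψ (src Γ k) (tgt Γ k) p   ≡⟨ ≡.cong (gain ψ _ _) (T-irrelevant p (edgeAdj Γ k)) ⟩
      ψₖ                             ≈⟨ central-cancel s₁-central ψₖ ⟨
      s₁ ∙ (ψₖ ∙ s₁ ⁻¹)              ≡⟨ Ψ-at (phaseOf ψ) e p (inj₁ ≡.refl) (inj₂ ≡.refl) ⟨
      Ψ Γ s₁ s₂ (phaseOf ψ) _ _ p    ∎
      where
      ψₖ : Carrier
      ψₖ = gain ψ (src Γ k) (tgt Γ k) (edgeAdj Γ k)
    at {k} e@(inj₂ (≡.refl , ≡.refl)) p = begin
      gain ψ (tgt Γ k) (src Γ k) p   ≈⟨ gain-inv ψ _ _ (edgeAdj Γ k) p ⟩
      ψₖ ⁻¹                          ≈⟨ cancelˡ s₁-involution _ ⟨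
      s₁ ∙ (s₁ ∙ ψₖ ⁻¹)              ≡⟨ Ψ-at (phaseOf ψ) e p (inj₂ ≡.refl) (inj₁ ≡.refl) ⟨
      Ψ Γ s₁ s₂ (phaseOf ψ) _ _ p    ∎
      where
      ψₖ : Carrier
      ψₖ = gain ψ (src Γ k) (tgt Γ k) (edgeAdj Γ k)

  ΨL-gain : Phase Γ s₁ s₂ → Gain (LAdj Γ)
  ΨL-gain H = record { gain = ΨL Γ s₁ s₂ H ; gain-inv = ΨL-inv }
    where
    ΨL-inv : ∀ j k (p : LAdj Γ j k) (q : LAdj Γ k j) →
      ΨL Γ s₁ s₂ H k j q ≈ (ΨL Γ s₁ s₂ H j k p) ⁻¹
    ΨL-inv j k p q = begin
      s₂ ∙ ((H (meet Γ q) k _) ⁻¹ ∙ H (meet Γ q) j _)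
        ≡⟨ ≡.cong₂ (λ x y → s₂ ∙ (x ⁻¹ ∙ y))
             (entry-cong H (meet-comm Γ p q) ≡.refl _ (meetR Γ p))
             (entry-cong H (meet-comm Γ p q) ≡.refl _ (meetL Γ p)) ⟩
      s₂ ∙ ((H (meet Γ p) k _) ⁻¹ ∙ H (meet Γ p) j _)   ≈⟨ ∙-congˡ (⁻¹-anti-homo-\\ _ _) ⟨
      s₂ ∙ ((H (meet Γ p) j _) ⁻¹ ∙ H (meet Γ p) k _) ⁻¹
        ≈⟨ central-involution-⁻¹ s₂-central s₂-involution _ ⟨
      (ΨL Γ s₁ s₂ H j k p) ⁻¹                            ∎

  compatible-switch : ∀ ψ ζ → Compatible Γ s₁ s₂ ψ ζ →
    ∀ ψ′ ζ′ → SwitchEq ψ ψ′ → SwitchEq ζ ζ′ → Compatible Γ s₁ s₂ ψ′ ζ′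
  compatible-switch _ _ (H , ψ≈ , ζ≈) _ _ (f , ψ′≈) (g , ζ′≈) = switchPhase f g H ,
    (λ u v p → trans (ψ′≈ u v p)
      (trans (switched-cong (f u) (f v) (ψ≈ u v p)) (sym (Ψ-switchPhase f g H u v p)))) ,
    (λ j k p → trans (ζ′≈ j k p)
      (trans (switched-cong (g j) (g k) (ζ≈ j k p)) (sym (ΨL-switchPhase f g H j k p))))

  compatible⇒𝓛 : ∀ ψ ζ → Compatible Γ s₁ s₂ ψ ζ → 𝓛[_]≡[_] Γ s₁ s₂ ψ ζ
  compatible⇒𝓛 ψ ζ (H₀ , ψ≈ , ζ≈) H φ χ φ≈ χ≈ (f , ψ≈φ) with Ψ-rigid f H₀ H Ψ≈
    where
    Ψ≈ : ∀ u v p → Ψ Γ s₁ s₂ H₀ u v p ≈ switched (f u) (Ψ Γ s₁ s₂ H u v p) (f v)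
    Ψ≈ u v p = trans (sym (ψ≈ u v p)) (trans (ψ≈φ u v p) (switched-cong (f u) (f v) (φ≈ u v p)))
  ... | g , H₀≈ = g , λ j k p → begin
    gain ζ j k p                                 ≈⟨ ζ≈ j k p ⟩
    ΨL Γ s₁ s₂ H₀ j k p                          ≈⟨ ΨL-cong H₀≈ j k p ⟩
    ΨL Γ s₁ s₂ (switchPhase f g H) j k p         ≈⟨ ΨL-switchPhase f g H j k p ⟩
    switched (g j) (ΨL Γ s₁ s₂ H j k p) (g k)    ≈⟨ switched-cong (g j) (g k) (χ≈ j k p) ⟨
    switched (g j) (gain χ j k p) (g k)          ∎

  𝓛⇒compatible : ∀ ψ ζ → 𝓛[_]≡[_] Γ s₁ s₂ ψ ζ → Compatible Γ s₁ s₂ ψ ζ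
  𝓛⇒compatible ψ ζ 𝓛ψ≡ζ =
    compatible-switch ψ (ΨL-gain (phaseOf ψ)) canonical ψ ζ (switchEq-refl ψ) switch-to-ζ
    where
    switch-to-ζ : SwitchEq (ΨL-gain (phaseOf ψ)) ζ
    switch-to-ζ = 𝓛ψ≡ζ (phaseOf ψ) ψ (ΨL-gain (phaseOf ψ)) (Ψ-phaseOf ψ) (λ _ _ _ → refl)
      (switchEq-refl ψ)

    canonical : Compatible Γ s₁ s₂ ψ (ΨL-gain (phaseOf ψ))
    canonical = phaseOf ψ , Ψ-phaseOf ψ , λ _ _ _ → refl

corollary4p26 : ∀ {c ℓ : Level} (Γ : Graph) (G : Group c ℓ) →
    Connected Γ → 1 ≤ m Γ →
    (s₁ s₂ : Group.Carrier G) →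
    GainTheory.Central G s₁ → GainTheory.Central G s₂ →
    Group._≈_ G (Group._∙_ G s₁ s₁) (Group.ε G) →
    Group._≈_ G (Group._∙_ G s₂ s₂) (Group.ε G) →
    (ψ : GainTheory.Gain G (Adj Γ)) (ζ : GainTheory.Gain G (LAdj Γ)) →
    (GainTheory.Compatible G Γ s₁ s₂ ψ ζ ⇔ GainTheory.𝓛[_]≡[_] G Γ s₁ s₂ ψ ζ)
    × (GainTheory.Compatible G Γ s₁ s₂ ψ ζ →
       ∀ (ψ′ : GainTheory.Gain G (Adj Γ)) (ζ′ : GainTheory.Gain G (LAdj Γ)) →
       GainTheory.SwitchEq G ψ ψ′ → GainTheory.SwitchEq G ζ ζ′ →
       GainTheory.Compatible G Γ s₁ s₂ ψ′ ζ′)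
corollary4p26 Γ G _ _ s₁ s₂ s₁-central s₂-central s₁-involution s₂-involution ψ ζ =
  mk⇔ (compatible⇒𝓛 ψ ζ) (𝓛⇒compatible ψ ζ) , compatible-switch ψ ζ
  where open Compatibility Γ G s₁ s₂ s₁-central s₂-central s₁-involution s₂-involution
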